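{- Every apex-forest on $n\geq 2$ vertices is a minor of $\Gamma_{n-1}^{+}$.
   Context: All graphs are finite and simple. A graph $H$ is an apex-forest if $H-v$ is a forest for some $v\in V(H)$. $\Gamma_m$ is the complete binary tree of height $m$ (rooted; every non-leaf vertex has two children; $2^m$ leaves; every root-to-leaf path has $m$ edges), and $\Gamma_m^+$ is obtained from $\Gamma_m$ by adding one new vertex adjacent to all leaves of $\Gamma_m$. -}

module Defs where

open import Level using (0ℓ)
open import Data.Nat using (ℕ; zero; suc; _+_; _*_; _∸_; _^_; _≤_; _≟_; _≤?_; s≤s)
open import Data.Nat.Properties using (<⇒≢; m≤m+n; m≤n⇒m≤1+n)
open import Data.Fin using (Fin; zero; suc; toℕ; inject₁; fromℕ; punchIn)
open import Data.Product using (Σ; ∃; ∃-syntax; _×_; _,_)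
open import Data.Sum using (_⊎_; inj₁; inj₂)
open import Relation.Nullary.Decidable using (_⊎-dec_; yes; no)
open import Data.Empty using (⊥)
open import Relation.Nullary using (¬_; Dec)
open import Relation.Binary.PropositionalEquality using (_≡_)
open import Function.Definitions using (Injective)

record Graph (n : ℕ) : Set₁ where
  field
    Adj    : Fin n → Fin n → Set
    sym    : ∀ {u v} → Adj u v → Adj v u
    irrefl : ∀ {u} → ¬ Adj u u
    dec    : ∀ u v → Dec (Adj u v)
open Graph public

record Cycle {n : ℕ} (G : Graph n) : Set where
  field
    k     : ℕ
    f     : Fin (suc (suc (suc k))) → Fin n
    inj   : Injective _≡_ _≡_ f
    step  : ∀ (i : Fin (suc (suc k))) → Adj G (f (inject₁ i)) (f (suc i))
    close : Adj G (f (fromℕ (suc (suc k)))) (f zero)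

Forest : ∀ {n} → Graph n → Set
Forest G = ¬ Cycle G

_─_ : ∀ {k} → Graph (suc k) → Fin (suc k) → Graph k
G ─ v = record
  { Adj    = λ i j → Adj G (punchIn v i) (punchIn v j)
  ; sym    = sym G
  ; irrefl = irrefl G
  ; dec    = λ i j → dec G (punchIn v i) (punchIn v j)
  }

ApexForest : ∀ {n} → Graph n → Set
ApexForest {zero}  H = ⊥
ApexForest {suc k} H = ∃[ v ] Forest (H ─ v)

data Walk {n : ℕ} (G : Graph n) (P : Fin n → Set) : Fin n → Fin n → Set where
  here : ∀ {u} → P u → Walk G P u u
  step : ∀ {u w v} → P u → Adj G u w → Walk G P w v → Walk G P u v

-- The vertex set P induces a connected subgraph of G (P nonempty is required separately).
Connected : ∀ {n} → Graph n → (Fin n → Set) → Set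
Connected G P = ∀ u v → P u → P v → Walk G P u v

record Minor {h g : ℕ} (H : Graph h) (G : Graph g) : Set₁ where
  field
    B        : Fin h → Fin g → Set
    nonempty : ∀ x → ∃[ v ] B x v
    disjoint : ∀ x y v → B x v → B y v → x ≡ y
    conn     : ∀ x → Connected G (B x)
    edges    : ∀ x y → Adj H x y → ∃[ u ] ∃[ v ] (B x u × B y v × Adj G u v)

-- Complete binary tree Γ_m, heap-indexed: vertices 0 .. 2^(m+1)-2, root 0,
-- children of i are 2i+1 and 2i+2.
-- (2i+1 and 2i+2 are written suc (i + i), suc (suc (i + i)).)
ChildOf : ℕ → ℕ → Set
ChildOf i j = (j ≡ suc (i + i)) ⊎ (j ≡ suc (suc (i + i)))

childOf-irrefl : ∀ {i} → ¬ ChildOf i i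
childOf-irrefl {i} (inj₁ e) = <⇒≢ (s≤s (m≤m+n i i)) e
childOf-irrefl {i} (inj₂ e) = <⇒≢ (s≤s (m≤n⇒m≤1+n (m≤m+n i i))) e

childOf? : ∀ i j → Dec (ChildOf i j)
childOf? i j = (j ≟ suc (i + i)) ⊎-dec (j ≟ suc (suc (i + i)))

ΓAdj : ∀ {N} → Fin N → Fin N → Set
ΓAdj u v = ChildOf (toℕ u) (toℕ v) ⊎ ChildOf (toℕ v) (toℕ u)

ΓAdj-sym : ∀ {N} {u v : Fin N} → ΓAdj u v → ΓAdj v u
ΓAdj-sym (inj₁ p) = inj₂ p
ΓAdj-sym (inj₂ p) = inj₁ p

ΓAdj-irrefl : ∀ {N} {u : Fin N} → ¬ ΓAdj u u
ΓAdj-irrefl (inj₁ p) = childOf-irrefl p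
ΓAdj-irrefl (inj₂ p) = childOf-irrefl p

Γ : (m : ℕ) → Graph (2 ^ suc m ∸ 1)
Γ m = record
  { Adj    = ΓAdj
  ; sym    = ΓAdj-sym
  ; irrefl = ΓAdj-irrefl
  ; dec    = λ u v → childOf? (toℕ u) (toℕ v) ⊎-dec childOf? (toℕ v) (toℕ u)
  }

-- Leaves of Γ m: the vertices without children, i.e. indices ≥ 2^m - 1
-- (there are exactly 2^m of them).
IsLeaf : (m : ℕ) → Fin (2 ^ suc m ∸ 1) → Set
IsLeaf m i = 2 ^ m ∸ 1 ≤ toℕ i

-- Adding one new vertex (numbered zero; old vertex i becomes suc i)
-- adjacent exactly to the vertices satisfying the decidable predicate P.
addApex : ∀ {N} → Graph N → (P : Fin N → Set) → (∀ i → Dec (P i)) → Graph (suc N)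
addApex {N} G P P? = record { Adj = A ; sym = λ {u} {v} → s u v ; irrefl = λ {u} → ir u ; dec = d }
  where
  A : Fin (suc N) → Fin (suc N) → Set
  A zero    zero    = ⊥
  A zero    (suc j) = P j
  A (suc i) zero    = P i
  A (suc i) (suc j) = Adj G i j
  s : ∀ u v → A u v → A v u
  s zero    zero    ()
  s zero    (suc j) p = p
  s (suc i) zero    p = p
  s (suc i) (suc j) p = sym G p
  ir : ∀ u → ¬ A u u
  ir zero    ()
  ir (suc i) p = irrefl G p
  d : ∀ u v → Dec (A u v)
  d zero    zero    = no λ ()
  d zero    (suc j) = P? j
  d (suc i) zero    = P? i
  d (suc i) (suc j) = dec G i j

Γ⁺ : (m : ℕ) → Graph (suc (2 ^ suc m ∸ 1))
Γ⁺ m = addApex (Γ m) (IsLeaf m) (λ i → 2 ^ m ∸ 1 ≤? toℕ i)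

-- Label the vertices of the complete binary tree Γ m in heap order starting
-- from 1 (root 1, children of X are 2X and 2X+1), so the labels are
-- 1 .. 2^(m+1) - 1 and the leaves are the labels in [2^m, 2^(m+1)).  Every
-- label is uniquely 2^s · (2q+1); the "chain" of an odd number 2q+1 is the
-- set {2^s · (2q+1)}: a path going down by left children from the node
-- 2q+1 to a leaf.  The chains partition the tree, the node 2q+1 is the right
-- child of the node q, and every chain reaches the leaf level.
--
-- A chain labelling of a forest F on k vertices assigns to every vertex i a
-- chain, with distinct vertices getting distinct chains that reach level k,
-- such that for each edge ij the top of one chain hangs (as a right child)
-- below a node of the other.  Such labellings exist by induction, removing a
-- vertex of degree ≤ 1 (every nonempty forest has one: take the first vertex
-- of a maximal path).  Given an apex v with H - v a forest, the chains of a
-- labelling of H - v are branch sets in Γ m; the apex of Γ⁺ m, adjacent to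
-- every leaf, is the branch set of v.

module Submission where

open import Defs
open import Data.Nat using (ℕ; zero; suc; _+_; _*_; _∸_; _^_; _≤_; _<_; z≤n; s≤s; s≤s⁻¹)
open import Data.Nat.Properties
  using ( ≤-refl; ≤-trans; ≤-<-trans; <-≤-trans; n<1+n; 1+n≰n; m≤n⇒m≤1+n; n≤1+n
        ; +-suc; +-identityʳ; *-suc; *-assoc; *-identityˡ; suc-injective
        ; *-cancelˡ-≡; *-cancelˡ-<; *-monoʳ-≤; *-monoʳ-<; m≤n*m; m≤m+n; m^n≢0; m^n>0; <-trans
        ; ^-monoʳ-<; ∸-monoˡ-≤; ∸-monoˡ-<; even≢odd )
open import Data.Fin using (Fin; zero; suc; toℕ; inject₁; inject≤; fromℕ; fromℕ<; punchIn; punchOut; _≟_)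
open import Data.Fin.Properties
  using ( toℕ-injective; toℕ<n; toℕ-inject₁; toℕ-inject≤; toℕ-fromℕ; toℕ-fromℕ<
        ; inject≤-injective; punchIn-injective; punchIn-punchOut; injective⇒≤; any?; all? )
open import Data.Product using (Σ; ∃; ∃-syntax; _×_; _,_; proj₁; proj₂)
open import Data.Sum using (_⊎_; inj₁; inj₂)
open import Data.Empty using (⊥; ⊥-elim)
open import Relation.Nullary using (yes; no)
open import Relation.Nullary.Decidable using (_×-dec_; ¬?)
open import Relation.Binary.PropositionalEquality as ≡ using (_≡_; _≢_; refl; cong; subst; trans)
open import Function.Definitions using (Injective)

record Path {n : ℕ} (G : Graph n) (l : ℕ) : Set where
  field
    vertex   : Fin (suc l) → Fin n
    distinct : Injective _≡_ _≡_ vertex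
    adjacent : ∀ (i : Fin l) → Adj G (vertex (inject₁ i)) (vertex (suc i))
open Path

inject≤-inject₁ : ∀ {k n} (i : Fin k) .(p : suc k ≤ suc n) .(p′ : k ≤ n) →
                  inject≤ (inject₁ i) p ≡ inject₁ (inject≤ i p′)
inject≤-inject₁ i p p′ = toℕ-injective (begin
  toℕ (inject≤ (inject₁ i) p)  ≡⟨ toℕ-inject≤ (inject₁ i) p ⟩
  toℕ (inject₁ i)              ≡⟨ toℕ-inject₁ i ⟩
  toℕ i                        ≡⟨ ≡.sym (toℕ-inject≤ i p′) ⟩
  toℕ (inject≤ i p′)           ≡⟨ ≡.sym (toℕ-inject₁ (inject≤ i p′)) ⟩
  toℕ (inject₁ (inject≤ i p′)) ∎)
  where open ≡.≡-Reasoning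

inject≤-fromℕ-toℕ : ∀ {n} (b : Fin n) → inject≤ (fromℕ (toℕ b)) (toℕ<n b) ≡ b
inject≤-fromℕ-toℕ b =
  toℕ-injective (trans (toℕ-inject≤ (fromℕ (toℕ b)) (toℕ<n b)) (toℕ-fromℕ (toℕ b)))

-- A chord from the first vertex of a path to a vertex two or more steps
-- along it closes a cycle: the initial segment up to that vertex.
chord⇒cycle : ∀ {n} {G : Graph n} {l} (P : Path G (suc (suc l))) (c : Fin (suc l)) →
              Adj G (vertex P zero) (vertex P (suc (suc c))) → Cycle G
chord⇒cycle {n} {G} {l} P c chord = record
  { k     = toℕ c
  ; f     = segment
  ; inj   = λ e → inject≤-injective _ _ _ _ (distinct P e)
  ; step  = λ i → subst (λ z → Adj G (vertex P z) (segment (suc i)))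
                        (≡.sym (inject≤-inject₁ i b≤ (s≤s⁻¹ b≤)))
                        (adjacent P (inject≤ i (s≤s⁻¹ b≤)))
  ; close = sym G (subst (λ z → Adj G (vertex P zero) (vertex P z))
                         (≡.sym (inject≤-fromℕ-toℕ (suc (suc c)))) chord)
  }
  where
  b≤ : suc (suc (suc (toℕ c))) ≤ suc (suc (suc l))
  b≤ = toℕ<n (suc (suc c))
  segment : Fin (suc (suc (suc (toℕ c)))) → Fin n
  segment i = vertex P (inject≤ i b≤)

AtMostOneNeighbour : ∀ {n} → Graph n → Fin n → Set
AtMostOneNeighbour G x = ∀ {y z} → Adj G x y → Adj G x z → y ≡ z

forest-path-neighbour : ∀ {n} {G : Graph n} {l} → Forest G → (P : Path G l) (i : Fin (suc l)) →
                        Adj G (vertex P zero) (vertex P i) → toℕ i ≡ 1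
forest-path-neighbour {G = G} _  P zero          a = ⊥-elim (irrefl G a)
forest-path-neighbour         _  P (suc zero)    a = refl
forest-path-neighbour {l = suc (suc _)} fo P (suc (suc c)) a = ⊥-elim (fo (chord⇒cycle P c a))

blocked-end : ∀ {n} {G : Graph n} {l} → Forest G → (P : Path G l) →
              (∀ {w} → Adj G (vertex P zero) w → ∃ λ i → vertex P i ≡ w) →
              AtMostOneNeighbour G (vertex P zero)
blocked-end fo P onPath ay az with onPath ay | onPath az
... | i , refl | j , refl =
  cong (vertex P) (toℕ-injective (trans (forest-path-neighbour fo P i ay)
                                        (≡.sym (forest-path-neighbour fo P j az))))

prepend : ∀ {n} {G : Graph n} {l} (P : Path G l) {w} → Adj G (vertex P zero) w →
          (∀ i → vertex P i ≢ w) → Path G (suc l)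
prepend {n} {G} {l} P {w} a off = record { vertex = vertex′ ; distinct = distinct′ ; adjacent = adjacent′ }
  where
  vertex′ : Fin (suc (suc l)) → Fin n
  vertex′ zero    = w
  vertex′ (suc i) = vertex P i
  distinct′ : Injective _≡_ _≡_ vertex′
  distinct′ {zero}  {zero}  _ = refl
  distinct′ {zero}  {suc j} e = ⊥-elim (off j (≡.sym e))
  distinct′ {suc i} {zero}  e = ⊥-elim (off i e)
  distinct′ {suc i} {suc j} e = cong suc (distinct P e)
  adjacent′ : ∀ (i : Fin (suc l)) → Adj G (vertex′ (inject₁ i)) (vertex′ (suc i))
  adjacent′ zero    = sym G a
  adjacent′ (suc i) = adjacent P i

extend-or-blocked : ∀ {n} {G : Graph n} {l} (P : Path G l) →
  (∃ λ w → Adj G (vertex P zero) w × (∀ i → vertex P i ≢ w)) ⊎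
  (∀ {w} → Adj G (vertex P zero) w → ∃ λ i → vertex P i ≡ w)
extend-or-blocked {G = G} P
  with any? (λ w → dec G (vertex P zero) w ×-dec all? (λ i → ¬? (vertex P i ≟ w)))
... | yes ext = inj₁ ext
... | no noExt = inj₂ onPath
  where
  onPath : ∀ {w} → Adj G (vertex P zero) w → ∃ λ i → vertex P i ≡ w
  onPath {w} a with any? (λ i → vertex P i ≟ w)
  ... | yes found = found
  ... | no  none  = ⊥-elim (noExt (w , a , λ i e → none (i , e)))

-- Extend a path at its front until it is blocked.  A path in a graph on n
-- vertices has at most n vertices, so `fuel` more extensions always suffice.
grow : ∀ {n} {G : Graph n} → Forest G → ∀ fuel {l} → n ≤ suc l + fuel → Path G l →
       ∃ (AtMostOneNeighbour G)
grow fo fuel _ P with extend-or-blocked P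
... | inj₂ blocked = vertex P zero , blocked-end fo P blocked
grow {n} fo zero {l} n≤ P | inj₁ (w , a , off) =
  ⊥-elim (1+n≰n (≤-trans (injective⇒≤ (distinct (prepend P a off)))
                         (subst (n ≤_) (+-identityʳ (suc l)) n≤)))
grow {n} fo (suc fuel) {l} n≤ P | inj₁ (w , a , off) =
  grow fo fuel (subst (n ≤_) (+-suc (suc l) fuel) n≤) (prepend P a off)

forest-has-leaf : ∀ {k} {G : Graph (suc k)} → Forest G → ∃ (AtMostOneNeighbour G)
forest-has-leaf {k} {G} fo = grow fo k ≤-refl trivial
  where
  trivial : Path G 0
  trivial = record { vertex = λ _ → zero ; distinct = λ { {zero} {zero} _ → refl } ; adjacent = λ () }

forest-─ : ∀ {k} {G : Graph (suc k)} x → Forest G → Forest (G ─ x)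
forest-─ x fo c = fo record
  { k     = Cycle.k c
  ; f     = λ i → punchIn x (Cycle.f c i)
  ; inj   = λ e → Cycle.inj c (punchIn-injective x _ _ e)
  ; step  = Cycle.step c
  ; close = Cycle.close c
  }

data Split {k} (x : Fin (suc k)) : Fin (suc k) → Set where
  the   : Split x x
  other : (i : Fin k) → Split x (punchIn x i)

split : ∀ {k} (x z : Fin (suc k)) → Split x z
split x z with x ≟ z
... | yes refl = the
... | no  x≢z  = subst (Split x) (punchIn-punchOut x≢z) (other (punchOut x≢z))

odd : ℕ → ℕ
odd q = suc (2 * q)

InChain : ℕ → ℕ → Set
InChain o X = ∃[ s ] X ≡ 2 ^ s * o

chain-top : ∀ o → InChain o o
chain-top o = 0 , ≡.sym (*-identityˡ o)

chain-double : ∀ {o X} → InChain o X → InChain o (2 * X)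
chain-double {o} (s , e) = suc s , trans (cong (2 *_) e) (≡.sym (*-assoc 2 (2 ^ s) o))

chain-≥-top : ∀ {o X} → InChain o X → o ≤ X
chain-≥-top {o} (s , refl) = m≤n*m o (2 ^ s) {{m^n≢0 2 s}}

odd-part-unique : ∀ s r a b → 2 ^ s * odd a ≡ 2 ^ r * odd b → a ≡ b
odd-part-unique zero zero a b e =
  *-cancelˡ-≡ a b 2 (suc-injective (trans (≡.sym (*-identityˡ (odd a))) (trans e (*-identityˡ (odd b)))))
odd-part-unique zero (suc r) a b e =
  ⊥-elim (even≢odd (2 ^ r * odd b) a
           (trans (≡.sym (*-assoc 2 (2 ^ r) (odd b))) (trans (≡.sym e) (*-identityˡ (odd a)))))
odd-part-unique (suc s) zero a b e =
  ⊥-elim (even≢odd (2 ^ s * odd a) b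
           (trans (≡.sym (*-assoc 2 (2 ^ s) (odd a))) (trans e (*-identityˡ (odd b)))))
odd-part-unique (suc s) (suc r) a b e =
  odd-part-unique s r a b
    (*-cancelˡ-≡ _ _ 2 (trans (≡.sym (*-assoc 2 (2 ^ s) (odd a))) (trans e (*-assoc 2 (2 ^ r) (odd b)))))

chains-disjoint : ∀ {a b X} → InChain (odd a) X → InChain (odd b) X → a ≡ b
chains-disjoint {a} {b} (s , e) (r , e′) = odd-part-unique s r a b (trans (≡.sym e) e′)

chain-level : ∀ {q X k} → InChain (odd q) X → X < 2 ^ suc k → q < 2 ^ k
chain-level {q} {k = k} c X< =
  *-cancelˡ-< 2 q (2 ^ k) (≤-trans (n≤1+n (suc (2 * q))) (≤-<-trans (chain-≥-top c) X<))

odd-next-level : ∀ k {L} → 2 ^ k ≤ L → L < 2 ^ suc k →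
                 2 ^ suc k ≤ odd L × odd L < 2 ^ suc (suc k)
odd-next-level k {L} L≥ L< =
  m≤n⇒m≤1+n (*-monoʳ-≤ 2 L≥) ,
  subst (_≤ 2 ^ suc (suc k)) (*-suc 2 L) (*-monoʳ-≤ 2 L<)

-- A chain labelling of F: vertex i gets the chain of 2 (q i) + 1; these are
-- distinct, each reaches level k at `bottom i`, and along every edge the
-- top of one chain hangs below a node (q of the other endpoint) of the other.
record ChainLabelling {k : ℕ} (F : Graph k) : Set where
  field
    q         : Fin k → ℕ
    q-inj     : ∀ {i j} → q i ≡ q j → i ≡ j
    bottom    : Fin k → ℕ
    bottom∈   : ∀ i → InChain (odd (q i)) (bottom i)
    bottom-≥  : ∀ i → 2 ^ k ≤ bottom i
    bottom-<  : ∀ i → bottom i < 2 ^ suc k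
    hang      : ∀ {i j} → Adj F i j → InChain (odd (q j)) (q i) ⊎ InChain (odd (q i)) (q j)

  q-< : ∀ i → q i < 2 ^ k
  q-< i = chain-level {k = k} (bottom∈ i) (bottom-< i)

-- Extending a chain labelling of F ─ x to F, for x of degree ≤ 1: the old
-- chains grow by one node at the bottom (into the new leaf level), and x gets
-- a new chain hanging below the bottom of its neighbour's chain.
module Extend {k} (F : Graph (suc k)) (x : Fin (suc k)) (leaf : AtMostOneNeighbour F x)
              (ℒ : ChainLabelling (F ─ x)) where
  open ChainLabelling ℒ

  -- The node below which the chain of x will hang: a leaf of the chain of
  -- the unique neighbour of x, or any node on level k if x is isolated.
  anchor : Σ ℕ λ L → 2 ^ k ≤ L × L < 2 ^ suc k ×
                     (∀ j → Adj F x (punchIn x j) → InChain (odd (q j)) L)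
  anchor with any? (λ j → dec F x (punchIn x j))
  ... | yes (j , a) = bottom j , bottom-≥ j , bottom-< j , below-neighbour
    where
    below-neighbour : ∀ j′ → Adj F x (punchIn x j′) → InChain (odd (q j′)) (bottom j)
    below-neighbour j′ a′ =
      subst (λ i → InChain (odd (q i)) (bottom j)) (punchIn-injective x j j′ (leaf a a′)) (bottom∈ j)
  ... | no isolated = 2 ^ k , ≤-refl , ^-monoʳ-< 2 (s≤s (s≤s z≤n)) (n<1+n k) ,
                      λ j a → ⊥-elim (isolated (j , a))

  L : ℕ
  L = proj₁ anchor

  L-≥ : 2 ^ k ≤ L
  L-≥ = proj₁ (proj₂ anchor)

  L-< : L < 2 ^ suc k
  L-< = proj₁ (proj₂ (proj₂ anchor))

  L-below : ∀ j → Adj F x (punchIn x j) → InChain (odd (q j)) L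
  L-below = proj₂ (proj₂ (proj₂ anchor))

  q′ bottom′ : ∀ {z} → Split x z → ℕ
  q′ the       = L
  q′ (other i) = q i
  bottom′ the       = odd L
  bottom′ (other i) = 2 * bottom i

  q′-inj : ∀ {z w} (sz : Split x z) (sw : Split x w) → q′ sz ≡ q′ sw → z ≡ w
  q′-inj the       the       _ = refl
  q′-inj the       (other j) e = ⊥-elim (1+n≰n (<-≤-trans (q-< j) (subst (2 ^ k ≤_) e L-≥)))
  q′-inj (other i) the       e = ⊥-elim (1+n≰n (<-≤-trans (q-< i) (subst (2 ^ k ≤_) (≡.sym e) L-≥)))
  q′-inj (other i) (other j) e = cong (punchIn x) (q-inj e)

  bottom′∈ : ∀ {z} (sz : Split x z) → InChain (odd (q′ sz)) (bottom′ sz)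
  bottom′∈ the       = chain-top (odd L)
  bottom′∈ (other i) = chain-double (bottom∈ i)

  bottom′-≥ : ∀ {z} (sz : Split x z) → 2 ^ suc k ≤ bottom′ sz
  bottom′-≥ the       = proj₁ (odd-next-level k L-≥ L-<)
  bottom′-≥ (other i) = *-monoʳ-≤ 2 (bottom-≥ i)

  bottom′-< : ∀ {z} (sz : Split x z) → bottom′ sz < 2 ^ suc (suc k)
  bottom′-< the       = proj₂ (odd-next-level k L-≥ L-<)
  bottom′-< (other i) = *-monoʳ-< 2 (bottom-< i)

  hang′ : ∀ {z w} (sz : Split x z) (sw : Split x w) → Adj F z w →
          InChain (odd (q′ sw)) (q′ sz) ⊎ InChain (odd (q′ sz)) (q′ sw)
  hang′ the       the       a = ⊥-elim (irrefl F a)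
  hang′ the       (other j) a = inj₁ (L-below j a)
  hang′ (other i) the       a = inj₂ (L-below i (sym F a))
  hang′ (other i) (other j) a = hang a

  labelling : ChainLabelling F
  labelling = record
    { q        = λ z → q′ (split x z)
    ; q-inj    = λ {z} {w} → q′-inj (split x z) (split x w)
    ; bottom   = λ z → bottom′ (split x z)
    ; bottom∈  = λ z → bottom′∈ (split x z)
    ; bottom-≥ = λ z → bottom′-≥ (split x z)
    ; bottom-< = λ z → bottom′-< (split x z)
    ; hang     = λ {z} {w} → hang′ (split x z) (split x w)
    }

forest-labelling : ∀ {k} (F : Graph k) → Forest F → ChainLabelling F
forest-labelling {zero} F _ = record
  { q = λ () ; q-inj = λ {} ; bottom = λ () ; bottom∈ = λ () ; bottom-≥ = λ () ; bottom-< = λ ()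
  ; hang = λ {} }
forest-labelling {suc k} F fo with forest-has-leaf fo
... | x , leaf = Extend.labelling F x leaf (forest-labelling (F ─ x) (forest-─ x fo))

_++ʷ_ : ∀ {n} {G : Graph n} {P} {u v w} → Walk G P u v → Walk G P v w → Walk G P u w
here _       ++ʷ w′ = w′
step p a w   ++ʷ w′ = step p a (w ++ʷ w′)

walk-start : ∀ {n} {G : Graph n} {P} {u v} → Walk G P u v → P u
walk-start (here p)     = p
walk-start (step p _ _) = p

reverseʷ : ∀ {n} {G : Graph n} {P} {u v} → Walk G P u v → Walk G P v u
reverseʷ         (here p)     = here p
reverseʷ {G = G} (step p a w) = reverseʷ w ++ʷ step (walk-start w) (sym G a) (here p)

Old : ∀ {N} → (Fin N → Set) → Fin (suc N) → Set
Old P zero    = ⊥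
Old P (suc u) = P u

lift-walk : ∀ {N} {G : Graph N} {A A?} {P} {u v} → Walk G P u v → Walk (addApex G A A?) (Old P) (suc u) (suc v)
lift-walk (here p)     = here p
lift-walk (step p a w) = step p a (lift-walk w)

lift-connected : ∀ {N} {G : Graph N} {A A?} {P} → Connected G P → Connected (addApex G A A?) (Old P)
lift-connected conn (suc u) (suc v) pu pv = lift-walk (conn u v pu pv)

-- Heap indices use i + i, the labels below use 2 * n.
double : ∀ n → 2 * n ≡ n + n
double n = cong (n +_) (+-identityʳ n)

double-suc : ∀ p → 2 * suc p ≡ suc (suc (p + p))
double-suc p = trans (*-suc 2 p) (cong (λ z → suc (suc z)) (double p))

module Tree (m : ℕ) where

  N : ℕ
  N = 2 ^ suc m ∸ 1

  -- Heap label of a node: root 1, the children of X are 2X and 2X + 1.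
  label : Fin N → ℕ
  label u = suc (toℕ u)

  node : ∀ {X} → 1 ≤ X → X < 2 ^ suc m → Σ (Fin N) λ u → label u ≡ X
  node {suc a} _ X< = fromℕ< (∸-monoˡ-< X< (s≤s z≤n)) , cong suc (toℕ-fromℕ< _)

  parent : ∀ u P → label u ≡ 2 * P → Σ (Fin N) λ p → label p ≡ P × Adj (Γ m) p u
  parent u (suc p) e = fromℕ< p<N , cong suc (toℕ-fromℕ< p<N) ,
                       inj₁ (inj₁ (trans u≡ (cong (λ z → suc (z + z)) (≡.sym (toℕ-fromℕ< p<N)))))
    where
    u≡ : toℕ u ≡ suc (p + p)
    u≡ = suc-injective (trans e (double-suc p))
    p<N : p < N
    p<N = ≤-<-trans (subst (p ≤_) (≡.sym u≡) (m≤n⇒m≤1+n (m≤m+n p p))) (toℕ<n u)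

  right-child : ∀ b t → toℕ t ≡ 2 * label b → Adj (Γ m) b t
  right-child b t e = inj₁ (inj₂ (trans e (double-suc (toℕ b))))

  Chain : ℕ → Fin N → Set
  Chain o u = InChain o (label u)

  to-top : ∀ {o} t → label t ≡ o → ∀ s u → label u ≡ 2 ^ s * o → Walk (Γ m) (Chain o) u t
  to-top {o} t t≡ zero u e
    with toℕ-injective {i = u} {j = t} (suc-injective (trans e (trans (*-identityˡ o) (≡.sym t≡))))
  ... | refl = here (0 , e)
  to-top {o} t t≡ (suc s) u e with parent u (2 ^ s * o) (trans e (*-assoc 2 (2 ^ s) o))
  ... | p , p≡ , p-u = step (suc s , e) (sym (Γ m) p-u) (to-top t t≡ s p p≡)

  -- A chain of an odd number is connected in Γ m (its top exists, being
  -- above any of its nodes).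
  chain-connected : ∀ {q X} → InChain (odd q) X → X < 2 ^ suc m → Connected (Γ m) (Chain (odd q))
  chain-connected c X< u w (s , e) (r , e′) with node (s≤s z≤n) (≤-<-trans (chain-≥-top c) X<)
  ... | t , t≡ = to-top t t≡ s u e ++ʷ reverseʷ (to-top t t≡ r w e′)

  leaf-in-chain : ∀ {o X} → InChain o X → 2 ^ m ≤ X → X < 2 ^ suc m → Σ (Fin N) λ u → Chain o u × IsLeaf m u
  leaf-in-chain c X≥ X< with node (≤-trans (m^n>0 2 m) X≥) X<
  ... | u , refl = u , c , ∸-monoˡ-≤ 1 X≥

  -- If q lies in the chain of 2p + 1, the chain of 2q + 1 hangs below it: its top
  -- is the right child of the node labelled q.
  hanging-edge : ∀ {p q} → InChain (odd p) q → odd q < 2 ^ suc m →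
                 ∃[ u ] ∃[ w ] (Chain (odd q) u × Chain (odd p) w × Adj (Γ m) u w)
  hanging-edge {q = q} c odd< with node (≤-trans (s≤s z≤n) (chain-≥-top c)) (<-trans (s≤s (m≤n*m q 2)) odd<)
  ... | b , refl with node (s≤s z≤n) odd<
  ... | t , t≡ = t , b , chain-top-at , c , sym (Γ m) (right-child b t (suc-injective t≡))
    where
    chain-top-at : Chain (odd q) t
    chain-top-at = subst (InChain (odd q)) (≡.sym t≡) (chain-top (odd q))

-- From a chain labelling of H ─ v: the apex of Γ⁺ m is the branch set of v,
-- and every other vertex of H gets (the copy in Γ⁺ m of) its chain.
module ApexForestMinor {m} (H : Graph (suc m)) (v : Fin (suc m)) (ℒ : ChainLabelling (H ─ v)) where
  open ChainLabelling ℒ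
  open Tree m

  Branch : ∀ {x} → Split v x → Fin (suc N) → Set
  Branch the       = _≡ zero
  Branch (other i) = Old (Chain (odd (q i)))

  -- The bottom of the chain of i is a leaf of Γ m, hence adjacent to the apex.
  chain-leaf : ∀ i → Σ (Fin N) λ u → Chain (odd (q i)) u × IsLeaf m u
  chain-leaf i = leaf-in-chain (bottom∈ i) (bottom-≥ i) (bottom-< i)

  nonempty : ∀ {x} (sx : Split v x) → ∃ (Branch sx)
  nonempty the       = zero , refl
  nonempty (other i) = suc (proj₁ (chain-leaf i)) , proj₁ (proj₂ (chain-leaf i))

  disjoint : ∀ {x y} (sx : Split v x) (sy : Split v y) w → Branch sx w → Branch sy w → x ≡ y
  disjoint the       the       _       _  _  = refl
  disjoint the       (other j) zero    _  ()
  disjoint the       (other j) (suc u) () _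
  disjoint (other i) the       zero    () _
  disjoint (other i) the       (suc u) _  ()
  disjoint (other i) (other j) zero    () _
  disjoint (other i) (other j) (suc u) ci cj = cong (punchIn v) (q-inj (chains-disjoint ci cj))

  connected : ∀ {x} (sx : Split v x) → Connected (Γ⁺ m) (Branch sx)
  connected the       = λ { _ _ refl refl → here refl }
  connected (other i) = lift-connected (chain-connected {q i} (bottom∈ i) (bottom-< i))

  chain-edge : ∀ i j → InChain (odd (q j)) (q i) →
               ∃[ u ] ∃[ w ] (Branch (other i) u × Branch (other j) w × Adj (Γ⁺ m) u w)
  chain-edge i j c with hanging-edge {q j} {q i} c (≤-<-trans (chain-≥-top (bottom∈ i)) (bottom-< i))
  ... | u , w , cu , cw , a = suc u , suc w , cu , cw , a

  edges : ∀ {x y} (sx : Split v x) (sy : Split v y) → Adj H x y →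
          ∃[ u ] ∃[ w ] (Branch sx u × Branch sy w × Adj (Γ⁺ m) u w)
  edges the       the       a = ⊥-elim (irrefl H a)
  edges the       (other j) _ with chain-leaf j
  ... | u , cu , leaf = zero , suc u , refl , cu , leaf
  edges (other i) the       _ with chain-leaf i
  ... | u , cu , leaf = suc u , zero , cu , refl , leaf
  edges (other i) (other j) a with hang a
  ... | inj₁ c = chain-edge i j c
  ... | inj₂ c with chain-edge j i c
  ...   | u , w , cu , cw , a′ = w , u , cw , cu , sym (Γ⁺ m) {u} {w} a′

  minor : Minor H (Γ⁺ m)
  minor = record
    { B        = λ x → Branch (split v x)
    ; nonempty = λ x → nonempty (split v x)
    ; disjoint = λ x y → disjoint (split v x) (split v y)
    ; conn     = λ x → connected (split v x)
    ; edges    = λ x y → edges (split v x) (split v y)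
    }

apex-forest-minor : ∀ m (H : Graph (suc m)) v → Forest (H ─ v) → Minor H (Γ⁺ m)
apex-forest-minor m H v fo = ApexForestMinor.minor H v (forest-labelling (H ─ v) fo)

-- The theorem.
lemma2p2 : ∀ (n : ℕ) (H : Graph n) → 2 ≤ n → ApexForest H → Minor H (Γ⁺ (n ∸ 1))
lemma2p2 zero    H () _
lemma2p2 (suc m) H _  (v , forest) = apex-forest-minor m H v forest
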